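{- Let $k\ge1$, $n\ge2$, $m=kn+1$, $n'=n-1$, $m'=kn'+1$. Let $D\in\mathcal D_{m,n}$ and $D'\in\mathcal D_{m',n'}$ with $\mathrm{red}(T(D))=T(D')$. If the first entry of the bottom row of $T(D)$ is $k+j$, then $\mathrm{area}(D)=\mathrm{area}(D')+j-1$.
   Context: $\mathcal D_{m,n}$ (coprime $m,n$) is the set of lattice paths from $(0,0)$ to $(m,n)$ with unit North and East steps staying weakly above the segment from $(0,0)$ to $(m,n)$; $\mathrm{SW}(D)$ is its step word ($S$ for North, $W$ for East). $\mathrm{area}(D)$ is the number of unit cells between $D$ and the main diagonal not cut by the diagonal. For $m=kn+1$, $T(D)$ is the array with $k+1$ rows and $n$ columns produced by the filling algorithm: place $1$ at the top of column 1; for $i=2,\dots,m+n-1$, if the $i$-th letter of $\mathrm{SW}(D)$ is $S$ place $i$ at the top of the leftmost empty column, and if $W$ place $i$ immediately below the smallest active entry (lowest in its column and not in row $k+1$). $\mathrm{red}(T)$ is obtained from $T$ by deleting its first column and replacing the remaining entries by $1,\dots,(k+1)(n-1)$ order-preservingly. -}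

module Defs where

open import Data.Nat using (ℕ; zero; suc; _+_; _*_; _∸_; _≤_; _<_; _<ᵇ_; _≡ᵇ_)
open import Data.Bool using (Bool; true; false; if_then_else_; _∧_; not)
open import Data.List using (List; []; _∷_; _++_; map; concat; length; filterᵇ; take; drop; upTo; sum; last)
open import Data.Maybe using (Maybe; just; nothing)
open import Data.Product using (_×_; _,_)
open import Relation.Binary.PropositionalEquality using (_≡_)

data Step : Set where
  N E : Step

Path : Set
Path = List Step

data Letter : Set where
  S W : Letter

SW : Path → List Letter
SW = map λ { N → S ; E → W }

countN countE : Path → ℕ
countN []      = 0
countN (N ∷ p) = suc (countN p)
countN (E ∷ p) = countN p
countE []      = 0
countE (N ∷ p) = countE p
countE (E ∷ p) = suc (countE p)

-- Every lattice point (x,y) visited after the current point (x,y) stays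
-- weakly above the segment from (0,0) to (m,n), i.e. x*n ≤ y*m.
data StaysAbove (m n : ℕ) : ℕ → ℕ → Path → Set where
  done  : ∀ {x y} → StaysAbove m n x y []
  stepN : ∀ {x y p} → x * n ≤ suc y * m → StaysAbove m n x (suc y) p →
          StaysAbove m n x y (N ∷ p)
  stepE : ∀ {x y p} → suc x * n ≤ y * m → StaysAbove m n (suc x) y p →
          StaysAbove m n x y (E ∷ p)

record InD (m n : ℕ) (D : Path) : Set where
  field
    numE  : countE D ≡ m
    numN  : countN D ≡ n
    above : StaysAbove m n 0 0 D

-- Number of unit cells [a,a+1]×[y,y+1] in row y with x ≤ a < m lying
-- (weakly) above the diagonal, i.e. (a+1)*n ≤ y*m (not cut by it).
rowCells : (m n x y : ℕ) → ℕ
rowCells m n x y =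
  length (filterᵇ (λ a → not (a <ᵇ x) ∧ not (y * m <ᵇ suc a * n)) (upTo m))

-- Walk along the path from the current point (x,y); each North step
-- from height y at abscissa x contributes the cells of row y lying
-- between the path and the diagonal.
areaFrom : (m n x y : ℕ) → Path → ℕ
areaFrom m n x y []      = 0
areaFrom m n x y (N ∷ p) = rowCells m n x y + areaFrom m n x (suc y) p
areaFrom m n x y (E ∷ p) = areaFrom m n (suc x) y p

area : (m n : ℕ) → Path → ℕ
area m n D = areaFrom m n 0 0 D

-- An array is given as its list of columns, each listed top to bottom.
Array : Set
Array = List (List ℕ)

placeTop : ℕ → Array → Maybe Array
placeTop i []            = nothing
placeTop i ([] ∷ cs)     = just ((i ∷ []) ∷ cs)
placeTop i ((x ∷ c) ∷ cs) with placeTop i cs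
... | nothing  = nothing
... | just cs' = just ((x ∷ c) ∷ cs')

-- The active entry of a column (for arrays with k+1 rows): its lowest
-- entry, provided that entry is not in row k+1.
activeEntry : ℕ → List ℕ → Maybe ℕ
activeEntry k c = if length c <ᵇ suc k then last c else nothing

minMaybe : Maybe ℕ → Maybe ℕ → Maybe ℕ
minMaybe nothing  b        = b
minMaybe (just a) nothing  = just a
minMaybe (just a) (just b) = just (if b <ᵇ a then b else a)

smallestActive : ℕ → Array → Maybe ℕ
smallestActive k []       = nothing
smallestActive k (c ∷ cs) = minMaybe (activeEntry k c) (smallestActive k cs)

placeBelow : ℕ → ℕ → ℕ → Array → Array
placeBelow k v i = map λ c → appendIf (activeEntry k c) c
  where
  appendIf : Maybe ℕ → List ℕ → List ℕ
  appendIf (just u) c = if u ≡ᵇ v then c ++ (i ∷ []) else c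
  appendIf nothing  c = c

placeW : ℕ → ℕ → Array → Maybe Array
placeW k i A with smallestActive k A
... | nothing = nothing
... | just v  = just (placeBelow k v i A)

-- Process letters, the first of which is the i-th letter of the word.
run : ℕ → ℕ → List Letter → Array → Maybe Array
run k i []       A = just A
run k i (S ∷ w) A with placeTop i A
... | nothing = nothing
... | just A' = run k (suc i) w A'
run k i (W ∷ w) A with placeW k i A
... | nothing = nothing
... | just A' = run k (suc i) w A'

emptyCols : ℕ → Array
emptyCols zero    = []
emptyCols (suc n) = [] ∷ emptyCols n

initArray : ℕ → Array
initArray zero    = []
initArray (suc n) = (1 ∷ []) ∷ emptyCols n

-- T(D) for D ∈ 𝒟_{m,n}, m = k*n+1: letters i = 2, …, m+n-1 of SW(D)
-- are processed (nothing if the algorithm gets stuck).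
fill : (k n : ℕ) → Path → Maybe Array
fill k n D = run k 2 (take (k * n + 1 + n ∸ 2) (drop 1 (SW D))) (initArray n)

rank : List ℕ → ℕ → ℕ
rank xs x = suc (length (filterᵇ (λ y → y <ᵇ x) xs))

red : Array → Array
red []       = []
red (_ ∷ cs) = map (map (rank (concat cs))) cs

-- Entry access (0-indexed column, 0-indexed row)

nth : {A : Set} → List A → ℕ → Maybe A
nth []       _       = nothing
nth (x ∷ xs) zero    = just x
nth (x ∷ xs) (suc i) = nth xs i

entry : Array → (col row : ℕ) → Maybe ℕ
entry A col row with nth A col
... | nothing = nothing
... | just c  = nth c row

module Submission where

-- The North step of D leaving row y at abscissa x is letter x + y + 1 of SW(D) and has
-- y k - x cells of area to its right, so area(D) plus the sum of the positions of the North
-- steps is a constant, staircase k n. Those positions are exactly the column heads of T(D),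
-- and the same holds for D' and red(T(D)). Reduction lowers a head h by the number of entries
-- of the first column below h; as that column is full, with k + 1 entries,
-- rank(h) + (k + 1) = h + #{first-column entries above h}. The corollary thus amounts to
-- Σ_h #{first-column entries above h} = j - 1, the number of entries outside the first column
-- below its bottom entry k + j, and this is an invariant (Balance) of the filling algorithm.

open import Defs
open import Data.Nat using (ℕ; zero; suc; _+_; _*_; _∸_; _≤_; _<_; _⊓_; s≤s; z≤n; _<ᵇ_; _≡ᵇ_)
open import Data.Nat.Properties
open import Data.Bool using (Bool; T; true; false; not; _∧_; if_then_else_)
open import Data.List using (List; []; _∷_; _++_; _∷ʳ_; concat; filterᵇ; last; length; map; take; drop; upTo)
open import Data.Nat.ListAction using (sum)
open import Data.List.Properties using (length-++; length-map; map-++; map-id; upTo-∷ʳ)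
open import Data.List.Membership.Propositional using (_∈_)
open import Data.List.Membership.Propositional.Properties using (∈-++⁺ʳ; ∈-++⁺ˡ)
open import Data.List.Relation.Unary.Any using (Any; here; there)
open import Data.List.Reverse using (reverseView; []; _∶_∶ʳ_)
open import Data.List.Relation.Unary.All as All using (All; []; _∷_)
open import Data.List.Relation.Unary.AllPairs using (AllPairs; []; _∷_)
open import Data.List.Relation.Unary.AllPairs.Properties as AllPairs using ()
open import Data.Maybe using (just; nothing)
open import Data.Maybe.Properties using (just-injective)
open import Data.Product using (_,_; _×_; proj₁; proj₂; ∃)
open import Data.Sum using (_⊎_; inj₁; inj₂)
open import Data.Empty using (⊥; ⊥-elim)
open import Data.Unit using (tt)
open import Relation.Binary.PropositionalEquality
open import Relation.Binary.Definitions using (tri<; tri>; tri≈)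
open import Data.Nat.Tactic.RingSolver using (solve-∀)
open import Algebra.Properties.CommutativeSemigroup +-commutativeSemigroup using (x∙yz≈y∙xz; xy∙z≈xz∙y; x∙yz≈xz∙y)

<ᵇ-true⇒< : ∀ {a b} → (a <ᵇ b) ≡ true → a < b
<ᵇ-true⇒< {a} {b} e = <ᵇ⇒< a b (subst T (sym e) tt)

<ᵇ-false⇒≥ : ∀ {a b} → (a <ᵇ b) ≡ false → b ≤ a
<ᵇ-false⇒≥ e = ≮⇒≥ (λ lt → subst T e (<⇒<ᵇ lt))

<⇒<ᵇ-true : ∀ {a b} → a < b → (a <ᵇ b) ≡ true
<⇒<ᵇ-true {a} {b} lt with a <ᵇ b in e
... | true  = refl
... | false = ⊥-elim (<⇒≱ lt (<ᵇ-false⇒≥ e))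

≥⇒<ᵇ-false : ∀ {a b} → b ≤ a → (a <ᵇ b) ≡ false
≥⇒<ᵇ-false {a} {b} le with a <ᵇ b in e
... | false = refl
... | true  = ⊥-elim (<⇒≱ (<ᵇ-true⇒< e) le)

≡ᵇ-true⇒≡ : ∀ {a b} → (a ≡ᵇ b) ≡ true → a ≡ b
≡ᵇ-true⇒≡ {a} {b} e = ≡ᵇ⇒≡ a b (subst T (sym e) tt)

≡ᵇ-refl : ∀ a → (a ≡ᵇ a) ≡ true
≡ᵇ-refl a with a ≡ᵇ a | ≡⇒≡ᵇ a a refl
... | true | _ = refl

toℕ : Bool → ℕ
toℕ true  = 1
toℕ false = 0

count : (ℕ → Bool) → List ℕ → ℕ
count p []       = 0
count p (x ∷ xs) = toℕ (p x) + count p xs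

length-filterᵇ : ∀ p xs → length (filterᵇ p xs) ≡ count p xs
length-filterᵇ p [] = refl
length-filterᵇ p (x ∷ xs) with p x
... | true  = cong suc (length-filterᵇ p xs)
... | false = length-filterᵇ p xs

count-++ : ∀ p xs ys → count p (xs ++ ys) ≡ count p xs + count p ys
count-++ p []       ys = refl
count-++ p (x ∷ xs) ys = trans (cong (toℕ (p x) +_) (count-++ p xs ys)) (sym (+-assoc (toℕ (p x)) _ _))

∈⇒1≤count : ∀ {x xs} → x ∈ xs → 1 ≤ count (_≡ᵇ x) xs
∈⇒1≤count {x} (here refl) rewrite ≡ᵇ-refl x = s≤s z≤n
∈⇒1≤count {x} {y ∷ xs} (there x∈xs) = ≤-trans (∈⇒1≤count x∈xs) (m≤n+m _ (toℕ (y ≡ᵇ x)))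

count-<ᵇ+count->ᵇ : ∀ h xs → (∀ {x} → x ∈ xs → x ≢ h) →
  count (_<ᵇ h) xs + count (h <ᵇ_) xs ≡ length xs
count-<ᵇ+count->ᵇ h [] _ = refl
count-<ᵇ+count->ᵇ h (x ∷ xs) x≢h with <-cmp x h
... | tri< x<h _ _ rewrite <⇒<ᵇ-true x<h | ≥⇒<ᵇ-false (<⇒≤ x<h) =
  cong suc (count-<ᵇ+count->ᵇ h xs (λ m → x≢h (there m)))
... | tri≈ _ x≡h _ = ⊥-elim (x≢h (here refl) x≡h)
... | tri> _ _ h<x rewrite ≥⇒<ᵇ-false (<⇒≤ h<x) | <⇒<ᵇ-true h<x =
  trans (+-suc _ _) (cong suc (count-<ᵇ+count->ᵇ h xs (λ m → x≢h (there m))))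

count-<ᵇ-all : ∀ t xs → (∀ {x} → x ∈ xs → x ≤ t) → count (_<ᵇ suc t) xs ≡ length xs
count-<ᵇ-all t [] _ = refl
count-<ᵇ-all t (x ∷ xs) ≤t rewrite <⇒<ᵇ-true {x} {suc t} (s≤s (≤t (here refl))) =
  cong suc (count-<ᵇ-all t xs (λ m → ≤t (there m)))

count->ᵇ-none : ∀ t xs → (∀ {x} → x ∈ xs → x ≤ t) → count (suc t <ᵇ_) xs ≡ 0
count->ᵇ-none t [] _ = refl
count->ᵇ-none t (x ∷ xs) ≤t rewrite ≥⇒<ᵇ-false {suc t} {x} (m≤n⇒m≤1+n (≤t (here refl))) =
  count->ᵇ-none t xs (λ m → ≤t (there m))

distinct-++ : ∀ xs ys v {x} → count (_≡ᵇ v) (xs ++ ys) ≤ 1 → v ∈ xs → x ∈ ys → x ≢ v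
distinct-++ xs ys v le v∈xs x∈ys refl rewrite count-++ (_≡ᵇ v) xs ys =
  <-irrefl refl (≤-trans (+-mono-≤ (∈⇒1≤count v∈xs) (∈⇒1≤count x∈ys)) le)

oneTo : ℕ → List ℕ
oneTo zero    = []
oneTo (suc t) = oneTo t ∷ʳ suc t

count-oneTo-suc : ∀ p t → count p (oneTo (suc t)) ≡ count p (oneTo t) + toℕ (p (suc t))
count-oneTo-suc p t = trans (count-++ p (oneTo t) (suc t ∷ [])) (cong (count p (oneTo t) +_) (+-identityʳ _))

count-≡ᵇ-oneTo-> : ∀ t v → t < v → count (_≡ᵇ v) (oneTo t) ≡ 0
count-≡ᵇ-oneTo-> zero    v _   = refl
count-≡ᵇ-oneTo-> (suc t) v t<v rewrite count-oneTo-suc (_≡ᵇ v) t | count-≡ᵇ-oneTo-> t v (<-trans (n<1+n t) t<v)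
  with suc t ≡ᵇ v in e
... | false = refl
... | true  = ⊥-elim (<-irrefl (≡ᵇ-true⇒≡ e) t<v)

count-≡ᵇ-oneTo≤1 : ∀ t v → count (_≡ᵇ v) (oneTo t) ≤ 1
count-≡ᵇ-oneTo≤1 zero    v = z≤n
count-≡ᵇ-oneTo≤1 (suc t) v rewrite count-oneTo-suc (_≡ᵇ v) t with suc t ≡ᵇ v in e
... | false = subst (_≤ 1) (sym (+-identityʳ _)) (count-≡ᵇ-oneTo≤1 t v)
... | true with refl ← ≡ᵇ-true⇒≡ {suc t} {v} e rewrite count-≡ᵇ-oneTo-> t (suc t) (n<1+n t) = ≤-refl

count-≡ᵇ-oneTo-bounds : ∀ t v → 1 ≤ count (_≡ᵇ v) (oneTo t) → 1 ≤ v × v ≤ t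
count-≡ᵇ-oneTo-bounds zero    v ()
count-≡ᵇ-oneTo-bounds (suc t) v h rewrite count-oneTo-suc (_≡ᵇ v) t with suc t ≡ᵇ v in e
... | true with refl ← ≡ᵇ-true⇒≡ {suc t} {v} e = s≤s z≤n , ≤-refl
... | false with count-≡ᵇ-oneTo-bounds t v (subst (1 ≤_) (+-identityʳ _) h)
...   | 1≤v , v≤t = 1≤v , m≤n⇒m≤1+n v≤t

count-<ᵇ-oneTo : ∀ t s → count (_<ᵇ s) (oneTo t) ≡ (s ∸ 1) ⊓ t
count-<ᵇ-oneTo zero    s = sym (⊓-zeroʳ (s ∸ 1))
count-<ᵇ-oneTo (suc t) s rewrite count-oneTo-suc (_<ᵇ s) t | count-<ᵇ-oneTo t s with suc t <ᵇ s in e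
... | true  = let t<s∸1 = ∸-monoˡ-≤ 1 (<ᵇ-true⇒< {suc t} {s} e) in begin
  (s ∸ 1) ⊓ t + 1 ≡⟨ cong (_+ 1) (m≥n⇒m⊓n≡n (≤-trans (n≤1+n t) t<s∸1)) ⟩
  t + 1           ≡⟨ +-comm t 1 ⟩
  suc t           ≡⟨ sym (m≥n⇒m⊓n≡n t<s∸1) ⟩
  (s ∸ 1) ⊓ suc t ∎
  where open ≡-Reasoning
... | false = let s∸1≤t = ∸-monoˡ-≤ 1 (<ᵇ-false⇒≥ {suc t} {s} e) in begin
  (s ∸ 1) ⊓ t + 0 ≡⟨ +-identityʳ _ ⟩
  (s ∸ 1) ⊓ t     ≡⟨ m≤n⇒m⊓n≡m s∸1≤t ⟩
  s ∸ 1           ≡⟨ sym (m≤n⇒m⊓n≡m (m≤n⇒m≤1+n s∸1≤t)) ⟩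
  (s ∸ 1) ⊓ suc t ∎
  where open ≡-Reasoning

_≈ₘ_ : List ℕ → List ℕ → Set
xs ≈ₘ ys = ∀ p → count p xs ≡ count p ys

module EntriesOneTo (t : ℕ) (xs : List ℕ) (xs≈ : xs ≈ₘ oneTo t) where

  ∈⇒bounds : ∀ {x} → x ∈ xs → 1 ≤ x × x ≤ t
  ∈⇒bounds {x} x∈xs = count-≡ᵇ-oneTo-bounds t x (subst (1 ≤_) (xs≈ (_≡ᵇ x)) (∈⇒1≤count x∈xs))

  ∈⇒≤ : ∀ {x} → x ∈ xs → x ≤ t
  ∈⇒≤ x∈xs = proj₂ (∈⇒bounds x∈xs)

  unique : ∀ v → count (_≡ᵇ v) xs ≤ 1
  unique v = subst (_≤ 1) (sym (xs≈ (_≡ᵇ v))) (count-≡ᵇ-oneTo≤1 t v)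

  count-<ᵇ : ∀ s → s ≤ t → count (_<ᵇ s) xs ≡ s ∸ 1
  count-<ᵇ s s≤t = trans (xs≈ (_<ᵇ s)) (trans (count-<ᵇ-oneTo t s) (m≤n⇒m⊓n≡m (≤-trans (m∸n≤m s 1) s≤t)))

length-∷ʳ : ∀ (c : List ℕ) i → length (c ∷ʳ i) ≡ suc (length c)
length-∷ʳ c i = trans (length-++ c) (+-comm (length c) 1)

last-∷ʳ : ∀ (c : List ℕ) i → last (c ∷ʳ i) ≡ just i
last-∷ʳ []          i = refl
last-∷ʳ (x ∷ [])    i = refl
last-∷ʳ (x ∷ y ∷ c) i = last-∷ʳ (y ∷ c) i

last-∈ : ∀ (c : List ℕ) {u} → last c ≡ just u → u ∈ c
last-∈ (x ∷ [])    refl = here refl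
last-∈ (x ∷ y ∷ c) e    = there (last-∈ (y ∷ c) e)

last-∷ : ∀ (h : ℕ) c → ∃ λ u → last (h ∷ c) ≡ just u
last-∷ h []      = h , refl
last-∷ h (x ∷ c) = last-∷ x c

activeEntry-just : ∀ k c {u} → activeEntry k c ≡ just u → length c ≤ k × last c ≡ just u
activeEntry-just k c e with length c <ᵇ suc k in b
... | true = ≤-pred (<ᵇ-true⇒< b) , e

activeEntry-∈ : ∀ k c {u} → activeEntry k c ≡ just u → u ∈ c
activeEntry-∈ k c e = last-∈ c (proj₂ (activeEntry-just k c e))

activeEntry-notFull : ∀ k c → length c ≤ k → activeEntry k c ≡ last c
activeEntry-notFull k c le rewrite <⇒<ᵇ-true (s≤s le) = refl

ActiveAtLeast : ℕ → ℕ → List ℕ → Set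
ActiveAtLeast k v c = ∀ u → activeEntry k c ≡ just u → v ≤ u

minMaybe-just : ∀ a b {v} → minMaybe a b ≡ just v →
  (a ≡ just v × (∀ u → b ≡ just u → v ≤ u)) ⊎ (b ≡ just v × (∀ u → a ≡ just u → v ≤ u))
minMaybe-just nothing  b        e    = inj₂ (e , λ _ ())
minMaybe-just (just a) nothing  refl = inj₁ (refl , λ _ ())
minMaybe-just (just a) (just b) e with b <ᵇ a in lt
minMaybe-just (just a) (just b) refl | true  = inj₂ (refl , λ { _ refl → <⇒≤ (<ᵇ-true⇒< lt) })
minMaybe-just (just a) (just b) refl | false = inj₁ (refl , λ { _ refl → <ᵇ-false⇒≥ lt })

smallestActive-nothing : ∀ k cs → smallestActive k cs ≡ nothing → All (λ c → activeEntry k c ≡ nothing) cs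
smallestActive-nothing k []       _ = []
smallestActive-nothing k (c ∷ cs) e with activeEntry k c in e₁ | smallestActive k cs in e₂
... | nothing | nothing = e₁ ∷ smallestActive-nothing k cs e₂
smallestActive-nothing k (c ∷ cs) () | nothing | just _
smallestActive-nothing k (c ∷ cs) () | just _  | nothing
smallestActive-nothing k (c ∷ cs) () | just _  | just _

smallestActive-∈ : ∀ k cs {v} → smallestActive k cs ≡ just v → Any (λ c → activeEntry k c ≡ just v) cs
smallestActive-∈ k (c ∷ cs) e with minMaybe-just (activeEntry k c) (smallestActive k cs) e
... | inj₁ (a≡v , _) = here a≡v
... | inj₂ (b≡v , _) = there (smallestActive-∈ k cs b≡v)

smallestActive-minimal : ∀ k cs {v} → smallestActive k cs ≡ just v → All (ActiveAtLeast k v) cs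
smallestActive-minimal k (c ∷ cs) {v} e with minMaybe-just (activeEntry k c) (smallestActive k cs) e
... | inj₂ (b≡v , v≤a) = v≤a ∷ smallestActive-minimal k cs b≡v
... | inj₁ (a≡v , v≤b) = (λ u a≡u → ≤-reflexive (just-injective (trans (sym a≡v) a≡u))) ∷ rest
  where
  rest : All (ActiveAtLeast k v) cs
  rest with smallestActive k cs in e′
  ... | nothing = All.map (λ { none u a≡u → case (trans (sym none) a≡u) }) (smallestActive-nothing k cs e′)
    where
    case : ∀ {u} → nothing ≡ just u → v ≤ u
    case ()
  ... | just w = All.map (λ w≤ u a≡u → ≤-trans (v≤b w refl) (w≤ u a≡u)) (smallestActive-minimal k cs e′)

appendBelow : ℕ → ℕ → ℕ → List ℕ → List ℕ
appendBelow k v i c with activeEntry k c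
... | nothing = c
... | just u  = if u ≡ᵇ v then c ∷ʳ i else c

placeBelow-map : ∀ k v i A → placeBelow k v i A ≡ map (appendBelow k v i) A
placeBelow-map k v i []      = refl
placeBelow-map k v i (c ∷ A) with activeEntry k c
... | nothing = cong (c ∷_) (placeBelow-map k v i A)
... | just u  = cong (_ ∷_) (placeBelow-map k v i A)

appendBelow-active : ∀ k v i c → activeEntry k c ≡ just v → appendBelow k v i c ≡ c ∷ʳ i
appendBelow-active k v i c e with activeEntry k c
appendBelow-active k v i c refl | just .v rewrite ≡ᵇ-refl v = refl

appendBelow-inactive : ∀ k v i c → (∀ u → activeEntry k c ≡ just u → u ≢ v) → appendBelow k v i c ≡ c
appendBelow-inactive k v i c u≢v with activeEntry k c
... | nothing = refl
... | just u with u ≡ᵇ v in b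
...   | true  = ⊥-elim (u≢v u refl (≡ᵇ-true⇒≡ b))
...   | false = refl

appendBelow-absent : ∀ k v i (cs : Array) → count (_≡ᵇ v) (concat cs) ≡ 0 → map (appendBelow k v i) cs ≡ cs
appendBelow-absent k v i []       _ = refl
appendBelow-absent k v i (c ∷ cs) h rewrite count-++ (_≡ᵇ v) c (concat cs) =
  cong₂ _∷_ (appendBelow-inactive k v i c (λ { u a≡u refl → absent (∈⇒1≤count (activeEntry-∈ k c a≡u)) }))
            (appendBelow-absent k v i cs (m+n≡0⇒n≡0 (count (_≡ᵇ v) c) h))
  where
  absent : 1 ≤ count (_≡ᵇ v) c → ⊥
  absent le = <-irrefl refl (≤-trans le (≤-reflexive (m+n≡0⇒m≡0 _ h)))

active⇒1≤count : ∀ k v (cs : Array) → Any (λ c → activeEntry k c ≡ just v) cs → 1 ≤ count (_≡ᵇ v) (concat cs)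
active⇒1≤count k v (c ∷ cs) (here a≡v) rewrite count-++ (_≡ᵇ v) c (concat cs) =
  ≤-trans (∈⇒1≤count (activeEntry-∈ k c a≡v)) (m≤m+n _ _)
active⇒1≤count k v (c ∷ cs) (there any) rewrite count-++ (_≡ᵇ v) c (concat cs) =
  ≤-trans (active⇒1≤count k v cs any) (m≤n+m _ _)

placeBelow-split : ∀ k v i (cs : Array) → Any (λ c → activeEntry k c ≡ just v) cs →
  count (_≡ᵇ v) (concat cs) ≤ 1 →
  ∃ λ pre → ∃ λ c → ∃ λ post → cs ≡ pre ++ c ∷ post × activeEntry k c ≡ just v ×
    map (appendBelow k v i) cs ≡ pre ++ (c ∷ʳ i) ∷ post
placeBelow-split k v i (c ∷ cs) (here a≡v) le rewrite count-++ (_≡ᵇ v) c (concat cs) =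
  [] , c , cs , refl , a≡v , cong₂ _∷_ (appendBelow-active k v i c a≡v) (appendBelow-absent k v i cs absent)
  where
  absent : count (_≡ᵇ v) (concat cs) ≡ 0
  absent = n≤0⇒n≡0 (+-cancelˡ-≤ 1 _ _ (≤-trans (+-monoˡ-≤ _ (∈⇒1≤count (activeEntry-∈ k c a≡v))) le))
placeBelow-split k v i (c ∷ cs) (there any) le rewrite count-++ (_≡ᵇ v) c (concat cs)
  with placeBelow-split k v i cs any (≤-trans (m≤n+m _ _) le)
... | pre , c′ , post , refl , a≡v , eq =
  c ∷ pre , c′ , post , refl , a≡v ,
  cong₂ _∷_ (appendBelow-inactive k v i c (λ { u a≡u refl → twice (∈⇒1≤count (activeEntry-∈ k c a≡u)) })) eq
  where
  twice : 1 ≤ count (_≡ᵇ v) c → ⊥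
  twice h = <-irrefl refl (≤-trans (+-mono-≤ h (active⇒1≤count k v cs any)) le)

placeW-just : ∀ k i A {A′} → placeW k i A ≡ just A′ →
  ∃ λ v → smallestActive k A ≡ just v × A′ ≡ placeBelow k v i A
placeW-just k i A e with smallestActive k A
placeW-just k i A refl | just v = v , refl , refl

placeW-split : ∀ k i A {A′} → placeW k i A ≡ just A′ → (∀ v → count (_≡ᵇ v) (concat A) ≤ 1) →
  ∃ λ v → ∃ λ pre → ∃ λ c → ∃ λ post →
    A ≡ pre ++ c ∷ post × activeEntry k c ≡ just v × All (ActiveAtLeast k v) A × A′ ≡ pre ++ (c ∷ʳ i) ∷ post
placeW-split k i A e distinct with placeW-just k i A e
... | v , sa , refl with placeBelow-split k v i A (smallestActive-∈ k A sa) (distinct v)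
...   | pre , c , post , A≡ , a≡v , eq =
  v , pre , c , post , A≡ , a≡v , smallestActive-minimal k A sa , trans (placeBelow-map k v i A) eq

placeTop-split : ∀ i A {A′} → placeTop i A ≡ just A′ →
  ∃ λ pre → ∃ λ post → A ≡ pre ++ [] ∷ post × A′ ≡ pre ++ (i ∷ []) ∷ post
placeTop-split i ([] ∷ cs)      refl = [] , cs , refl , refl
placeTop-split i ((x ∷ c) ∷ cs) e with placeTop i cs in e′
placeTop-split i ((x ∷ c) ∷ cs) refl | just cs′ with placeTop-split i cs e′
... | pre , post , refl , refl = (x ∷ c) ∷ pre , post , refl , refl

sumBy : (List ℕ → ℕ) → Array → ℕ
sumBy f []       = 0
sumBy f (c ∷ cs) = f c + sumBy f cs

sumBy-mid : ∀ f (pre : Array) c post → sumBy f (pre ++ c ∷ post) ≡ f c + sumBy f (pre ++ post)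
sumBy-mid f []        c post = refl
sumBy-mid f (d ∷ pre) c post =
  trans (cong (f d +_) (sumBy-mid f pre c post)) (x∙yz≈y∙xz (f d) (f c) _)

sumBy-replace : ∀ f (pre : Array) c c′ post d → f c′ ≡ f c + d →
  sumBy f (pre ++ c′ ∷ post) ≡ sumBy f (pre ++ c ∷ post) + d
sumBy-replace f pre c c′ post d e
  rewrite sumBy-mid f pre c′ post | sumBy-mid f pre c post | e = xy∙z≈xz∙y (f c) d _

count-concat : ∀ p (A : Array) → count p (concat A) ≡ sumBy (count p) A
count-concat p []      = refl
count-concat p (c ∷ A) = trans (count-++ p c (concat A)) (cong (count p c +_) (count-concat p A))

∈-concat-mid : ∀ {x : ℕ} (pre : Array) {c post} → x ∈ c → x ∈ concat (pre ++ c ∷ post)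
∈-concat-mid []        x∈c = ∈-++⁺ˡ x∈c
∈-concat-mid (d ∷ pre) x∈c = ∈-++⁺ʳ d (∈-concat-mid pre x∈c)

All-mid⁻ : ∀ {P : List ℕ → Set} (pre : Array) {c post} → All P (pre ++ c ∷ post) → P c × All P (pre ++ post)
All-mid⁻ []        (pc ∷ ps) = pc , ps
All-mid⁻ (d ∷ pre) (pd ∷ ps) with All-mid⁻ pre ps
... | pc , ps′ = pc , pd ∷ ps′

All-mid⁺ : ∀ {P : List ℕ → Set} (pre : Array) {c post} → P c → All P (pre ++ post) → All P (pre ++ c ∷ post)
All-mid⁺ []        pc ps        = pc ∷ ps
All-mid⁺ (d ∷ pre) pc (pd ∷ ps) = pd ∷ All-mid⁺ pre pc ps

onHead : (ℕ → ℕ) → List ℕ → ℕ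
onHead f []      = 0
onHead f (h ∷ _) = f h

headSum : Array → ℕ
headSum = sumBy (onHead λ h → h)

nonEmptyCount : Array → ℕ
nonEmptyCount = sumBy (onHead λ _ → 1)

exceedingHead : List ℕ → List ℕ → ℕ
exceedingHead c₁ = onHead λ h → count (h <ᵇ_) c₁

lastExceeds : ℕ → List ℕ → ℕ
lastExceeds L c with last c
... | nothing = 0
... | just u  = toℕ (L <ᵇ u)

lastExceeds-last : ∀ L c {u} → last c ≡ just u → lastExceeds L c ≡ toℕ (L <ᵇ u)
lastExceeds-last L c e rewrite e = refl

LagsBehind : ℕ → ℕ → List ℕ → Set
LagsBehind ℓ L c = ∀ u → last c ≡ just u → length c ≤ ℓ × (u < L → suc (length c) ≤ ℓ)

-- The first column c₁, with bottom entry L, against the other columns cs. While c₁ is not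
-- full, the cells of cs number the pairs (head h of a column of cs, entry of c₁ larger than h)
-- plus the columns of cs whose bottom exceeds L; once c₁ is full, the same pairs number the
-- entries of cs smaller than L.
data Balance (k L : ℕ) (c₁ : List ℕ) (cs : Array) : Set where
  filling : length c₁ ≤ k →
            sumBy length cs ≡ sumBy (exceedingHead c₁) cs + sumBy (lastExceeds L) cs →
            All (LagsBehind (length c₁) L) cs →
            Balance k L c₁ cs
  full    : length c₁ ≡ suc k →
            count (_<ᵇ L) (concat cs) ≡ sumBy (exceedingHead c₁) cs →
            Balance k L c₁ cs

data FillInvariant (k t : ℕ) : Array → Set where
  invariant : ∀ {r cs L} →
    concat ((1 ∷ r) ∷ cs) ≈ₘ oneTo t →
    last (1 ∷ r) ≡ just L →
    AllPairs _<_ (1 ∷ r) →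
    length (1 ∷ r) ≤ suc k →
    Balance k L (1 ∷ r) cs →
    FillInvariant k t ((1 ∷ r) ∷ cs)

concat-emptyCols : ∀ n → concat (emptyCols n) ≡ []
concat-emptyCols zero    = refl
concat-emptyCols (suc n) = concat-emptyCols n

initArray-invariant : ∀ k n → 1 ≤ k → FillInvariant k 1 (initArray (suc n))
initArray-invariant k n 1≤k =
  invariant (λ p → cong (λ xs → count p (1 ∷ xs)) (concat-emptyCols n)) refl ([] ∷ []) (s≤s z≤n)
            (filling 1≤k (balanced n) (lagging n))
  where
  balanced : ∀ n → sumBy length (emptyCols n) ≡
                   sumBy (exceedingHead (1 ∷ [])) (emptyCols n) + sumBy (lastExceeds 1) (emptyCols n)
  balanced zero    = refl
  balanced (suc n) = balanced n
  lagging : ∀ n → All (LagsBehind 1 1) (emptyCols n)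
  lagging zero    = []
  lagging (suc n) = (λ _ ()) ∷ lagging n

≈ₘ-append : ∀ (pre : Array) c post t → concat (pre ++ c ∷ post) ≈ₘ oneTo t →
  concat (pre ++ (c ∷ʳ suc t) ∷ post) ≈ₘ oneTo (suc t)
≈ₘ-append pre c post t ≈ p = begin
  count p (concat (pre ++ (c ∷ʳ suc t) ∷ post))   ≡⟨ count-concat p (pre ++ (c ∷ʳ suc t) ∷ post) ⟩
  sumBy (count p) (pre ++ (c ∷ʳ suc t) ∷ post)    ≡⟨ sumBy-replace (count p) pre c (c ∷ʳ suc t) post _ (count-++ p c _) ⟩
  sumBy (count p) (pre ++ c ∷ post) + count p [i] ≡⟨ cong (_+ count p [i]) (sym (count-concat p (pre ++ c ∷ post))) ⟩
  count p (concat (pre ++ c ∷ post)) + count p [i] ≡⟨ cong (_+ count p [i]) (≈ p) ⟩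
  count p (oneTo t) + count p [i]                 ≡⟨ sym (count-++ p (oneTo t) [i]) ⟩
  count p (oneTo (suc t))                         ∎
  where
  open ≡-Reasoning
  [i] : List ℕ
  [i] = suc t ∷ []

exceedingHead-∷ʳ : ∀ c₁ c t → (∀ {x} → x ∈ c₁ → x ≤ t) →
  exceedingHead c₁ (c ∷ʳ suc t) ≡ exceedingHead c₁ c
exceedingHead-∷ʳ c₁ []      t ≤t = count->ᵇ-none t c₁ ≤t
exceedingHead-∷ʳ c₁ (h ∷ c) t ≤t = refl

room-below-L : ∀ {ℓ L} c → 1 ≤ ℓ → LagsBehind ℓ L c → (∀ u → last c ≡ just u → u < L) →
  suc (length c) ≤ ℓ × lastExceeds L c ≡ 0
room-below-L []      1≤ℓ _   _     = 1≤ℓ , refl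
room-below-L {L = L} (h ∷ c) 1≤ℓ lag below with last-∷ h c
... | u , lst = proj₂ (lag u lst) (below u lst) ,
                trans (lastExceeds-last L (h ∷ c) lst) (cong toℕ (≥⇒<ᵇ-false (<⇒≤ (below u lst))))

Balance-append : ∀ {k L c₁} pre c post t → 1 ≤ length c₁ → L ≤ t → (∀ {x} → x ∈ c₁ → x ≤ t) →
  (∀ u → last c ≡ just u → length c₁ ≤ k → u < L) →
  Balance k L c₁ (pre ++ c ∷ post) → Balance k L c₁ (pre ++ (c ∷ʳ suc t) ∷ post)
Balance-append {k} {L} {c₁} pre c post t 1≤ℓ L≤t c₁≤t below (filling ℓ≤k eq lags) =
  filling ℓ≤k eq′ (All-mid⁺ pre lagging (proj₂ (All-mid⁻ pre lags)))
  where
  i ℓ : ℕ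
  i = suc t
  ℓ = length c₁
  room : suc (length c) ≤ ℓ × lastExceeds L c ≡ 0
  room = room-below-L c 1≤ℓ (proj₁ (All-mid⁻ pre lags)) (λ u lst → below u lst ℓ≤k)
  lagging : LagsBehind ℓ L (c ∷ʳ i)
  lagging u lst with refl ← just-injective (trans (sym (last-∷ʳ c i)) lst) =
    subst (_≤ ℓ) (sym (length-∷ʳ c i)) (proj₁ room) , λ i<L → ⊥-elim (<⇒≱ i<L (m≤n⇒m≤1+n L≤t))
  exceeds : lastExceeds L (c ∷ʳ i) ≡ lastExceeds L c + 1
  exceeds rewrite lastExceeds-last L (c ∷ʳ i) (last-∷ʳ c i) | proj₂ room | <⇒<ᵇ-true (s≤s L≤t) = refl
  eq′ : sumBy length (pre ++ (c ∷ʳ i) ∷ post) ≡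
        sumBy (exceedingHead c₁) (pre ++ (c ∷ʳ i) ∷ post) + sumBy (lastExceeds L) (pre ++ (c ∷ʳ i) ∷ post)
  eq′ rewrite sumBy-replace length pre c (c ∷ʳ i) post 1 (trans (length-∷ʳ c i) (+-comm 1 _))
            | sumBy-replace (exceedingHead c₁) pre c (c ∷ʳ i) post 0 (trans (exceedingHead-∷ʳ c₁ c t c₁≤t) (sym (+-identityʳ _)))
            | sumBy-replace (lastExceeds L) pre c (c ∷ʳ i) post 1 exceeds | eq =
    regroup (sumBy (exceedingHead c₁) (pre ++ c ∷ post)) (sumBy (lastExceeds L) (pre ++ c ∷ post))
    where
    regroup : ∀ x z → x + z + 1 ≡ x + 0 + (z + 1)
    regroup = solve-∀
Balance-append {L = L} {c₁} pre c post t 1≤ℓ L≤t c₁≤t below (full ℓ≡ eq) = full ℓ≡ (begin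
  count (_<ᵇ L) (concat (pre ++ (c ∷ʳ i) ∷ post))   ≡⟨ count-concat (_<ᵇ L) (pre ++ (c ∷ʳ i) ∷ post) ⟩
  sumBy (count (_<ᵇ L)) (pre ++ (c ∷ʳ i) ∷ post)    ≡⟨ sumBy-replace (count (_<ᵇ L)) pre c (c ∷ʳ i) post 0 newNotBelow ⟩
  sumBy (count (_<ᵇ L)) (pre ++ c ∷ post) + 0       ≡⟨ cong (_+ 0) (trans (sym (count-concat (_<ᵇ L) (pre ++ c ∷ post))) eq) ⟩
  sumBy (exceedingHead c₁) (pre ++ c ∷ post) + 0    ≡⟨ sym (sumBy-replace (exceedingHead c₁) pre c (c ∷ʳ i) post 0
                                                         (trans (exceedingHead-∷ʳ c₁ c t c₁≤t) (sym (+-identityʳ _)))) ⟩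
  sumBy (exceedingHead c₁) (pre ++ (c ∷ʳ i) ∷ post) ∎)
  where
  open ≡-Reasoning
  i : ℕ
  i = suc t
  newNotBelow : count (_<ᵇ L) (c ∷ʳ i) ≡ count (_<ᵇ L) c + 0
  newNotBelow rewrite count-++ (_<ᵇ L) c (i ∷ []) | ≥⇒<ᵇ-false {i} {L} (m≤n⇒m≤1+n L≤t) = refl

placeTop-invariant : ∀ k t A {A′} → FillInvariant k t A → placeTop (suc t) A ≡ just A′ →
  FillInvariant k (suc t) A′
placeTop-invariant k t A inv e with placeTop-split (suc t) A e
placeTop-invariant k t _ (invariant _ _ _ _ _) e | [] , _ , () , _
placeTop-invariant k t _ (invariant {r} ≈ lst inc len bal) e | _ ∷ pre , post , refl , refl =
  invariant (≈ₘ-append ((1 ∷ r) ∷ pre) [] post t ≈) lst inc len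
            (Balance-append pre [] post t (s≤s z≤n) (c₁≤t (last-∈ (1 ∷ r) lst)) c₁≤t (λ _ ()) bal)
  where
  open EntriesOneTo t (concat ((1 ∷ r) ∷ pre ++ [] ∷ post)) ≈
  c₁≤t : ∀ {x} → x ∈ 1 ∷ r → x ≤ t
  c₁≤t x∈c₁ = ∈⇒≤ (∈-++⁺ˡ x∈c₁)

sumBy-exceedingHead-∷ʳ : ∀ c₁ t (cs : Array) → (∀ {x} → x ∈ concat cs → x ≤ t) →
  sumBy (exceedingHead (c₁ ∷ʳ suc t)) cs ≡ sumBy (exceedingHead c₁) cs + nonEmptyCount cs
sumBy-exceedingHead-∷ʳ c₁ t []             ≤t = refl
sumBy-exceedingHead-∷ʳ c₁ t ([] ∷ cs)      ≤t = sumBy-exceedingHead-∷ʳ c₁ t cs ≤t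
sumBy-exceedingHead-∷ʳ c₁ t ((h ∷ c) ∷ cs) ≤t
  rewrite count-++ (h <ᵇ_) c₁ (suc t ∷ []) | <⇒<ᵇ-true {h} {suc t} (s≤s (≤t (here refl)))
        | sumBy-exceedingHead-∷ʳ c₁ t cs (λ m → ≤t (∈-++⁺ʳ (h ∷ c) m)) =
  regroup (count (h <ᵇ_) c₁) (sumBy (exceedingHead c₁) cs) (nonEmptyCount cs)
  where
  regroup : ∀ a x y → a + 1 + (x + y) ≡ a + x + (1 + y)
  regroup = solve-∀

last-above : ∀ {k ℓ L} c {u} → ℓ ≤ k → last c ≡ just u → u ≢ L →
  ActiveAtLeast k L c → LagsBehind ℓ L c → L < u
last-above {k} {ℓ} {L} c {u} ℓ≤k lst u≢L L≤ lag with <-cmp L u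
... | tri< L<u _ _ = L<u
... | tri≈ _ L≡u _ = ⊥-elim (u≢L (sym L≡u))
... | tri> _ _ u<L = ⊥-elim (<⇒≱ u<L (L≤ u (trans (activeEntry-notFull k c short) lst)))
  where
  short : length c ≤ k
  short = ≤-pred (≤-trans (proj₂ (lag u lst) u<L) (m≤n⇒m≤1+n ℓ≤k))

sumBy-lastExceeds-active : ∀ {k ℓ L} (cs : Array) → ℓ ≤ k → (∀ {x} → x ∈ concat cs → x ≢ L) →
  All (ActiveAtLeast k L) cs → All (LagsBehind ℓ L) cs → sumBy (lastExceeds L) cs ≡ nonEmptyCount cs
sumBy-lastExceeds-active []             _   _   _          _            = refl
sumBy-lastExceeds-active ([] ∷ cs)      ℓ≤k ≢L (_ ∷ L≤s)  (_ ∷ lags)   = sumBy-lastExceeds-active cs ℓ≤k ≢L L≤s lags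
sumBy-lastExceeds-active {L = L} ((h ∷ c) ∷ cs) ℓ≤k ≢L (L≤ ∷ L≤s) (lag ∷ lags) with last-∷ h c
... | u , lst rewrite lastExceeds-last L (h ∷ c) lst
                    | <⇒<ᵇ-true (last-above (h ∷ c) ℓ≤k lst (≢L (∈-++⁺ˡ (last-∈ (h ∷ c) lst))) L≤ lag) =
  cong suc (sumBy-lastExceeds-active cs ℓ≤k (λ m → ≢L (∈-++⁺ʳ (h ∷ c) m)) L≤s lags)

sumBy-lastExceeds-max : ∀ t (cs : Array) → (∀ {x} → x ∈ concat cs → x ≤ t) → sumBy (lastExceeds (suc t)) cs ≡ 0
sumBy-lastExceeds-max t []             ≤t = refl
sumBy-lastExceeds-max t ([] ∷ cs)      ≤t = sumBy-lastExceeds-max t cs ≤t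
sumBy-lastExceeds-max t ((h ∷ c) ∷ cs) ≤t with last-∷ h c
... | u , lst rewrite lastExceeds-last (suc t) (h ∷ c) lst
                    | ≥⇒<ᵇ-false {suc t} {u} (m≤n⇒m≤1+n (≤t (∈-++⁺ˡ (last-∈ (h ∷ c) lst)))) =
  sumBy-lastExceeds-max t cs (λ m → ≤t (∈-++⁺ʳ (h ∷ c) m))

length-concat : ∀ (cs : Array) → length (concat cs) ≡ sumBy length cs
length-concat []       = refl
length-concat (c ∷ cs) = trans (length-++ c) (cong (length c +_) (length-concat cs))

serveFirstColumn : ∀ k t r cs {L} → concat ((1 ∷ r) ∷ cs) ≈ₘ oneTo t → last (1 ∷ r) ≡ just L →
  AllPairs _<_ (1 ∷ r) → length (1 ∷ r) ≤ k → Balance k L (1 ∷ r) cs → All (ActiveAtLeast k L) cs →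
  FillInvariant k (suc t) (((1 ∷ r) ∷ʳ suc t) ∷ cs)
serveFirstColumn k t r cs ≈ lst inc ℓ≤k (full ℓ≡ _) L≤s =
  ⊥-elim (<-irrefl refl (≤-trans (≤-reflexive (sym ℓ≡)) ℓ≤k))
serveFirstColumn k t r cs {L} ≈ lst inc ℓ≤k (filling _ eq lags) L≤s =
  invariant (≈ₘ-append [] c₁ cs t ≈) (last-∷ʳ c₁ i)
            (AllPairs.++⁺ inc ([] ∷ []) (All.tabulate λ m → s≤s (∈⇒≤ (∈-++⁺ˡ m)) ∷ []))
            (subst (_≤ suc k) (sym (length-∷ʳ c₁ i)) (s≤s ℓ≤k)) balance
  where
  open EntriesOneTo t (concat ((1 ∷ r) ∷ cs)) ≈
  i : ℕ
  i = suc t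
  c₁ : List ℕ
  c₁ = 1 ∷ r
  cs≤t : ∀ {x} → x ∈ concat cs → x ≤ t
  cs≤t m = ∈⇒≤ (∈-++⁺ʳ c₁ m)
  cells : sumBy length cs ≡ sumBy (exceedingHead (c₁ ∷ʳ i)) cs
  cells = begin
    sumBy length cs                                              ≡⟨ eq ⟩
    sumBy (exceedingHead c₁) cs + sumBy (lastExceeds L) cs        ≡⟨ cong (sumBy (exceedingHead c₁) cs +_)
      (sumBy-lastExceeds-active cs ℓ≤k (λ m → distinct-++ c₁ (concat cs) L (unique L) (last-∈ c₁ lst) m) L≤s lags) ⟩
    sumBy (exceedingHead c₁) cs + nonEmptyCount cs               ≡⟨ sym (sumBy-exceedingHead-∷ʳ c₁ t cs cs≤t) ⟩
    sumBy (exceedingHead (c₁ ∷ʳ i)) cs                           ∎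
    where open ≡-Reasoning
  balance : Balance k i (c₁ ∷ʳ i) cs
  balance with m≤n⇒m<n∨m≡n ℓ≤k
  ... | inj₁ ℓ<k = filling (subst (_≤ k) (sym (length-∷ʳ c₁ i)) ℓ<k)
                           (trans cells (sym (trans (cong (sumBy (exceedingHead (c₁ ∷ʳ i)) cs +_)
                                                          (sumBy-lastExceeds-max t cs cs≤t))
                                                    (+-identityʳ _))))
                           (subst (λ ℓ → All (LagsBehind ℓ i) cs) (sym (length-∷ʳ c₁ i))
                             (All.map (λ lag u lst → let ℓ≤ = proj₁ (lag u lst) in m≤n⇒m≤1+n ℓ≤ , λ _ → s≤s ℓ≤)
                                      lags))
  ... | inj₂ ℓ≡k = full (trans (length-∷ʳ c₁ i) (cong suc ℓ≡k))
                        (trans (count-<ᵇ-all t (concat cs) cs≤t) (trans (length-concat cs) cells))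

placeW-invariant : ∀ k t A {A′} → FillInvariant k t A → placeW k (suc t) A ≡ just A′ →
  FillInvariant k (suc t) A′
placeW-invariant k t _ (invariant {r} {cs} {L} ≈ lst inc len bal) e
  with placeW-split k (suc t) ((1 ∷ r) ∷ cs) e (EntriesOneTo.unique t (concat ((1 ∷ r) ∷ cs)) ≈)
... | v , [] , _ , _ , refl , active , _ ∷ v≤s , refl
  with refl ← just-injective (trans (sym lst) (proj₂ (activeEntry-just k (1 ∷ r) active))) =
  serveFirstColumn k t r cs ≈ lst inc (proj₁ (activeEntry-just k (1 ∷ r) active)) bal v≤s
... | v , _ ∷ pre , c , post , refl , active , v≤ ∷ _ , refl =
  invariant (≈ₘ-append ((1 ∷ r) ∷ pre) c post t ≈) lst inc len
            (Balance-append pre c post t (s≤s z≤n) (c₁≤t (last-∈ (1 ∷ r) lst)) c₁≤t below bal)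
  where
  open EntriesOneTo t (concat ((1 ∷ r) ∷ pre ++ c ∷ post)) ≈
  c₁≤t : ∀ {x} → x ∈ 1 ∷ r → x ≤ t
  c₁≤t x∈c₁ = ∈⇒≤ (∈-++⁺ˡ x∈c₁)
  below : ∀ u → last c ≡ just u → length (1 ∷ r) ≤ k → u < L
  below u lst-c ℓ≤k with refl ← just-injective (trans (sym (proj₂ (activeEntry-just k c active))) lst-c) =
    ≤∧≢⇒< (v≤ L (trans (activeEntry-notFull k (1 ∷ r) ℓ≤k) lst))
          (distinct-++ (1 ∷ r) _ L (unique L) (last-∈ (1 ∷ r) lst) (∈-concat-mid pre (activeEntry-∈ k c active)))

run-invariant : ∀ k w t A {A′} → FillInvariant k t A → run k (suc t) w A ≡ just A′ →
  ∃ λ t′ → FillInvariant k t′ A′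
run-invariant k []      t A inv refl = t , inv
run-invariant k (S ∷ w) t A inv e with placeTop (suc t) A in step
... | just A″ = run-invariant k w (suc t) A″ (placeTop-invariant k t A inv step) e
run-invariant k (W ∷ w) t A inv e with placeW k (suc t) A in step
... | just A″ = run-invariant k w (suc t) A″ (placeW-invariant k t A inv step) e

sPositions : ℕ → List Letter → List ℕ
sPositions i []      = []
sPositions i (S ∷ w) = i ∷ sPositions (suc i) w
sPositions i (W ∷ w) = sPositions (suc i) w

onHead-appendBelow : ∀ f k v i c → onHead f (appendBelow k v i c) ≡ onHead f c
onHead-appendBelow f k v i []      = refl
onHead-appendBelow f k v i (h ∷ c) with activeEntry k (h ∷ c)
... | nothing = refl
... | just u with u ≡ᵇ v
...   | true  = refl
...   | false = refl

sumBy-onHead-placeW : ∀ f k i A {A′} → placeW k i A ≡ just A′ → sumBy (onHead f) A′ ≡ sumBy (onHead f) A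
sumBy-onHead-placeW f k i A e with placeW-just k i A e
... | v , _ , refl rewrite placeBelow-map k v i A = heads-unchanged A
  where
  heads-unchanged : ∀ A → sumBy (onHead f) (map (appendBelow k v i) A) ≡ sumBy (onHead f) A
  heads-unchanged []      = refl
  heads-unchanged (c ∷ A) = cong₂ _+_ (onHead-appendBelow f k v i c) (heads-unchanged A)

sumBy-onHead-placeTop : ∀ f i A {A′} → placeTop i A ≡ just A′ → sumBy (onHead f) A′ ≡ sumBy (onHead f) A + f i
sumBy-onHead-placeTop f i A e with placeTop-split i A e
... | pre , post , refl , refl = sumBy-replace (onHead f) pre [] (i ∷ []) post (f i) refl

run-heads : ∀ f k w i A {A′} → run k i w A ≡ just A′ →
  sumBy (onHead f) A′ ≡ sumBy (onHead f) A + sum (map f (sPositions i w))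
run-heads f k []      i A refl = sym (+-identityʳ _)
run-heads f k (S ∷ w) i A e with placeTop i A in step
... | just A″ rewrite run-heads f k w (suc i) A″ e | sumBy-onHead-placeTop f i A step =
  +-assoc (sumBy (onHead f) A) (f i) _
run-heads f k (W ∷ w) i A e with placeW k i A in step
... | just A″ rewrite run-heads f k w (suc i) A″ e | sumBy-onHead-placeW f k i A step = refl

rank-shift : ∀ t c₁ cs → concat (c₁ ∷ cs) ≈ₘ oneTo t →
  ∀ {x} → x ∈ concat cs → rank (concat cs) x + length c₁ ≡ x + count (x <ᵇ_) c₁
rank-shift t c₁ cs ≈ {x} x∈cs = begin
  suc (length (filterᵇ (_<ᵇ x) (concat cs))) + length c₁
    ≡⟨ cong (λ z → suc z + length c₁) (length-filterᵇ (_<ᵇ x) (concat cs)) ⟩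
  suc (below-cs + length c₁)
    ≡⟨ cong (λ z → suc (below-cs + z)) (sym (count-<ᵇ+count->ᵇ x c₁ x∉c₁)) ⟩
  suc (below-cs + (below-c₁ + above-c₁))
    ≡⟨ cong suc (sym (+-assoc below-cs below-c₁ above-c₁)) ⟩
  suc (below-cs + below-c₁ + above-c₁)
    ≡⟨ cong (λ z → suc (z + above-c₁)) (+-comm below-cs below-c₁) ⟩
  suc (below-c₁ + below-cs + above-c₁)
    ≡⟨ cong (λ z → suc (z + above-c₁)) (sym (count-++ (_<ᵇ x) c₁ (concat cs))) ⟩
  suc (count (_<ᵇ x) (concat (c₁ ∷ cs)) + above-c₁)
    ≡⟨ cong (λ z → suc (z + above-c₁)) (count-<ᵇ x (∈⇒≤ x∈all)) ⟩
  suc (x ∸ 1 + above-c₁)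
    ≡⟨ cong (_+ above-c₁) (trans (+-comm 1 (x ∸ 1)) (m∸n+n≡m (proj₁ (∈⇒bounds x∈all)))) ⟩
  x + above-c₁ ∎
  where
  open ≡-Reasoning
  open EntriesOneTo t (concat (c₁ ∷ cs)) ≈
  below-cs below-c₁ above-c₁ : ℕ
  below-cs = count (_<ᵇ x) (concat cs)
  below-c₁ = count (_<ᵇ x) c₁
  above-c₁ = count (x <ᵇ_) c₁
  x∈all : x ∈ concat (c₁ ∷ cs)
  x∈all = ∈-++⁺ʳ c₁ x∈cs
  x∉c₁ : ∀ {y} → y ∈ c₁ → y ≢ x
  x∉c₁ y∈c₁ y≡x = distinct-++ c₁ (concat cs) _ (unique _) y∈c₁ x∈cs (sym y≡x)

sumBy-rank-heads : ∀ ℓ xs c₁ (cs : Array) →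
  (∀ {x} → x ∈ concat cs → rank xs x + ℓ ≡ x + count (x <ᵇ_) c₁) →
  sumBy (onHead (rank xs)) cs + ℓ * nonEmptyCount cs ≡ headSum cs + sumBy (exceedingHead c₁) cs
sumBy-rank-heads ℓ xs c₁ []             _     = *-zeroʳ ℓ
sumBy-rank-heads ℓ xs c₁ ([] ∷ cs)      shift = sumBy-rank-heads ℓ xs c₁ cs shift
sumBy-rank-heads ℓ xs c₁ ((h ∷ c) ∷ cs) shift = begin
  rank xs h + R + ℓ * (1 + M)          ≡⟨ regroup (rank xs h) R ℓ M ⟩
  (rank xs h + ℓ) + (R + ℓ * M)        ≡⟨ cong₂ _+_ (shift (here refl)) (sumBy-rank-heads ℓ xs c₁ cs (λ m → shift (∈-++⁺ʳ (h ∷ c) m))) ⟩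
  (h + count (h <ᵇ_) c₁) + (H + X)     ≡⟨ regroup′ h (count (h <ᵇ_) c₁) H X ⟩
  h + H + (count (h <ᵇ_) c₁ + X)       ∎
  where
  open ≡-Reasoning
  R M H X : ℕ
  R = sumBy (onHead (rank xs)) cs
  M = nonEmptyCount cs
  H = headSum cs
  X = sumBy (exceedingHead c₁) cs
  regroup : ∀ a r l n → a + r + l * (1 + n) ≡ (a + l) + (r + l * n)
  regroup = solve-∀
  regroup′ : ∀ a b h x → (a + b) + (h + x) ≡ a + h + (b + x)
  regroup′ = solve-∀

headSum-map : ∀ g (cs : Array) → headSum (map (map g) cs) ≡ sumBy (onHead g) cs
headSum-map g []             = refl
headSum-map g ([] ∷ cs)      = headSum-map g cs
headSum-map g ((h ∷ c) ∷ cs) = cong (g h +_) (headSum-map g cs)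

nth-bottom : ∀ (c : List ℕ) k {x} → nth c k ≡ just x → length c ≤ suc k → last c ≡ just x × length c ≡ suc k
nth-bottom (y ∷ [])    zero    refl _ = refl , refl
nth-bottom (y ∷ z ∷ c) zero    refl (s≤s ())
nth-bottom (y ∷ z ∷ c) (suc k) e    (s≤s le) with nth-bottom (z ∷ c) k e le
... | lst , len = lst , cong suc len

count-<ᵇ-last : ∀ (c : List ℕ) L → AllPairs _<_ c → last c ≡ just L → suc (count (_<ᵇ L) c) ≡ length c
count-<ᵇ-last (x ∷ [])    L _ refl rewrite ≥⇒<ᵇ-false {x} {x} ≤-refl = refl
count-<ᵇ-last (x ∷ y ∷ c) L (x< ∷ inc) lst
  rewrite <⇒<ᵇ-true (All.lookup x< (last-∈ (y ∷ c) lst)) = cong suc (count-<ᵇ-last (y ∷ c) L inc lst)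

m+n≡m+o∸1⇒n+1≡o : ∀ m n o → 1 ≤ m → m + n ≡ (m + o) ∸ 1 → n + 1 ≡ o
m+n≡m+o∸1⇒n+1≡o (suc m) n zero    _ e =
  ⊥-elim (<-irrefl refl (≤-trans (s≤s (m≤m+n m n)) (≤-reflexive (trans e (+-identityʳ m)))))
m+n≡m+o∸1⇒n+1≡o m       n (suc o) _ e =
  trans (+-comm n 1) (cong suc (+-cancelˡ-≡ m _ _ (trans e (cong (_∸ 1) (+-suc m o)))))

sumBy-exceedingHead-full : ∀ k t j c₁ cs → 1 ≤ k → concat (c₁ ∷ cs) ≈ₘ oneTo t → AllPairs _<_ c₁ →
  last c₁ ≡ just (k + j) → length c₁ ≡ suc k →
  count (_<ᵇ (k + j)) (concat cs) ≡ sumBy (exceedingHead c₁) cs →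
  sumBy (exceedingHead c₁) cs + 1 ≡ j
sumBy-exceedingHead-full k t j c₁ cs 1≤k ≈ inc lst len eq = m+n≡m+o∸1⇒n+1≡o k _ j 1≤k (begin
  k + sumBy (exceedingHead c₁) cs                      ≡⟨ cong₂ _+_ (sym below-in-c₁) (sym eq) ⟩
  count (_<ᵇ (k + j)) c₁ + count (_<ᵇ (k + j)) (concat cs) ≡⟨ sym (count-++ (_<ᵇ (k + j)) c₁ (concat cs)) ⟩
  count (_<ᵇ (k + j)) (concat (c₁ ∷ cs))                ≡⟨ count-<ᵇ (k + j) (∈⇒≤ (∈-++⁺ˡ (last-∈ c₁ lst))) ⟩
  k + j ∸ 1                                             ∎)
  where
  open ≡-Reasoning
  open EntriesOneTo t (concat (c₁ ∷ cs)) ≈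
  below-in-c₁ : count (_<ᵇ (k + j)) c₁ ≡ k
  below-in-c₁ = suc-injective (trans (count-<ᵇ-last c₁ (k + j) inc lst) len)

filled-rank-heads : ∀ k t T j → 1 ≤ k → FillInvariant k t T → entry T 0 k ≡ just (k + j) →
  ∃ λ r → ∃ λ cs → T ≡ (1 ∷ r) ∷ cs ×
    sumBy (onHead (rank (concat cs))) cs + suc k * nonEmptyCount cs + 1 ≡ headSum cs + j
filled-rank-heads k t _ j 1≤k (invariant {r} {cs} ≈ lst inc len bal) bottom
  with nth-bottom (1 ∷ r) k bottom len
... | lst′ , full-length with refl ← trans (sym lst) lst′ = r , cs , refl , identity bal
  where
  c₁ : List ℕ
  c₁ = 1 ∷ r
  identity : Balance k (k + j) c₁ cs →
             sumBy (onHead (rank (concat cs))) cs + suc k * nonEmptyCount cs + 1 ≡ headSum cs + j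
  identity (filling ℓ≤k _ _) = ⊥-elim (<-irrefl refl (subst (_≤ k) full-length ℓ≤k))
  identity (full _ eq) = begin
    sumBy (onHead (rank (concat cs))) cs + suc k * nonEmptyCount cs + 1
      ≡⟨ cong (_+ 1) (sumBy-rank-heads (suc k) (concat cs) c₁ cs
                        (λ {x} m → subst (λ ℓ → rank (concat cs) x + ℓ ≡ x + count (x <ᵇ_) c₁) full-length
                                                 (rank-shift t c₁ cs ≈ m))) ⟩
    headSum cs + sumBy (exceedingHead c₁) cs + 1
      ≡⟨ +-assoc (headSum cs) _ 1 ⟩
    headSum cs + (sumBy (exceedingHead c₁) cs + 1)
      ≡⟨ cong (headSum cs +_) (sumBy-exceedingHead-full k t j c₁ cs 1≤k ≈ inc lst full-length eq) ⟩
    headSum cs + j ∎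
    where open ≡-Reasoning

-- x ≤ y m / n = y k + y / n, where y / n < 1.
above-diagonal⇒≤ : ∀ k n x y → y < n → x * n ≤ y * (k * n + 1) → x ≤ y * k
above-diagonal⇒≤ k n x y y<n above with ≤-<-connex x (y * k)
... | inj₁ x≤yk = x≤yk
... | inj₂ yk<x = ⊥-elim (<⇒≱ y<n (+-cancelʳ-≤ (y * k * n) n y (begin
  n + y * k * n      ≡⟨ regroup n y k ⟩
  suc (y * k) * n    ≤⟨ *-monoˡ-≤ n yk<x ⟩
  x * n              ≤⟨ above ⟩
  y * (k * n + 1)    ≡⟨ regroup′ y k n ⟩
  y + y * k * n      ∎)))
  where
  open ≤-Reasoning
  regroup : ∀ n y k → n + y * k * n ≡ suc (y * k) * n
  regroup = solve-∀
  regroup′ : ∀ y k n → y * (k * n + 1) ≡ y + y * k * n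
  regroup′ = solve-∀

cell-above-diagonal : ∀ k n a y → y < n → not (y * (k * n + 1) <ᵇ suc a * n) ≡ (a <ᵇ y * k)
cell-above-diagonal k n a y y<n with a <ᵇ y * k in inside | y * (k * n + 1) <ᵇ suc a * n in cut
... | true  | false = refl
... | false | true  = refl
... | true  | true  = ⊥-elim (<⇒≱ (<ᵇ-true⇒< cut) (begin
  suc a * n          ≤⟨ *-monoˡ-≤ n (<ᵇ-true⇒< {a} {y * k} inside) ⟩
  y * k * n          ≤⟨ m≤m+n (y * k * n) y ⟩
  y * k * n + y      ≡⟨ regroup y k n ⟩
  y * (k * n + 1)    ∎))
  where
  open ≤-Reasoning
  regroup : ∀ y k n → y * k * n + y ≡ y * (k * n + 1)
  regroup = solve-∀
... | false | false =
  ⊥-elim (<⇒≱ (above-diagonal⇒≤ k n (suc a) y y<n (<ᵇ-false⇒≥ cut)) (<ᵇ-false⇒≥ inside))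

count-cong : ∀ {p q} → (∀ a → p a ≡ q a) → ∀ xs → count p xs ≡ count q xs
count-cong p≗q []       = refl
count-cong p≗q (x ∷ xs) = cong₂ _+_ (cong toℕ (p≗q x)) (count-cong p≗q xs)

m≤n⇒m⊓n≡m⊓1+n : ∀ {m n} → m ≤ n → m ⊓ n ≡ m ⊓ suc n
m≤n⇒m⊓n≡m⊓1+n m≤n = trans (m≤n⇒m⊓n≡m m≤n) (sym (m≤n⇒m⊓n≡m (m≤n⇒m≤1+n m≤n)))

interval-step : ∀ x b M → b ⊓ M ∸ x + (toℕ (not (M <ᵇ x) ∧ (M <ᵇ b)) + 0) ≡ b ⊓ suc M ∸ x
interval-step x b M with M <ᵇ x in M<x | M <ᵇ b in M<b
... | true  | false = trans (+-identityʳ _) (cong (_∸ x) (m≤n⇒m⊓n≡m⊓1+n (<ᵇ-false⇒≥ M<b)))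
... | false | false = trans (+-identityʳ _) (cong (_∸ x) (m≤n⇒m⊓n≡m⊓1+n (<ᵇ-false⇒≥ M<b)))
... | true  | true  = begin
  b ⊓ M ∸ x + 0   ≡⟨ +-identityʳ _ ⟩
  b ⊓ M ∸ x       ≡⟨ cong (_∸ x) (m≥n⇒m⊓n≡n (<⇒≤ (<ᵇ-true⇒< M<b))) ⟩
  M ∸ x           ≡⟨ m≤n⇒m∸n≡0 (<⇒≤ (<ᵇ-true⇒< {M} {x} M<x)) ⟩
  0               ≡⟨ sym (m≤n⇒m∸n≡0 (<ᵇ-true⇒< {M} {x} M<x)) ⟩
  suc M ∸ x       ≡⟨ cong (_∸ x) (sym (m≥n⇒m⊓n≡n (<ᵇ-true⇒< M<b))) ⟩
  b ⊓ suc M ∸ x   ∎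
  where open ≡-Reasoning
... | false | true  = begin
  b ⊓ M ∸ x + 1   ≡⟨ cong (λ z → z ∸ x + 1) (m≥n⇒m⊓n≡n (<⇒≤ (<ᵇ-true⇒< M<b))) ⟩
  M ∸ x + 1       ≡⟨ +-comm (M ∸ x) 1 ⟩
  1 + (M ∸ x)     ≡⟨ sym (+-∸-assoc 1 (<ᵇ-false⇒≥ {M} {x} M<x)) ⟩
  suc M ∸ x       ≡⟨ cong (_∸ x) (sym (m≥n⇒m⊓n≡n (<ᵇ-true⇒< M<b))) ⟩
  b ⊓ suc M ∸ x   ∎
  where open ≡-Reasoning

count-interval-upTo : ∀ x b M → count (λ a → not (a <ᵇ x) ∧ (a <ᵇ b)) (upTo M) ≡ (b ⊓ M) ∸ x
count-interval-upTo x b zero    = sym (trans (cong (_∸ x) (⊓-zeroʳ b)) (0∸n≡0 x))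
count-interval-upTo x b (suc M) = begin
  count inside (upTo (suc M))              ≡⟨ cong (count inside) (sym (upTo-∷ʳ M)) ⟩
  count inside (upTo M ∷ʳ M)               ≡⟨ count-++ inside (upTo M) (M ∷ []) ⟩
  count inside (upTo M) + count inside (M ∷ []) ≡⟨ cong (_+ count inside (M ∷ [])) (count-interval-upTo x b M) ⟩
  b ⊓ M ∸ x + count inside (M ∷ [])        ≡⟨ interval-step x b M ⟩
  b ⊓ suc M ∸ x                            ∎
  where
  open ≡-Reasoning
  inside : ℕ → Bool
  inside = λ a → not (a <ᵇ x) ∧ (a <ᵇ b)

rowCells-below : ∀ k n x y → y < n → x ≤ y * k → rowCells (k * n + 1) n x y ≡ y * k ∸ x
rowCells-below k n x y y<n x≤yk = begin
  rowCells (k * n + 1) n x y                                          ≡⟨ length-filterᵇ _ (upTo (k * n + 1)) ⟩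
  count (λ a → not (a <ᵇ x) ∧ not (y * (k * n + 1) <ᵇ suc a * n)) (upTo (k * n + 1))
    ≡⟨ count-cong (λ a → cong (not (a <ᵇ x) ∧_) (cell-above-diagonal k n a y y<n)) (upTo (k * n + 1)) ⟩
  count (λ a → not (a <ᵇ x) ∧ (a <ᵇ y * k)) (upTo (k * n + 1))        ≡⟨ count-interval-upTo x (y * k) (k * n + 1) ⟩
  (y * k) ⊓ (k * n + 1) ∸ x                                           ≡⟨ cong (_∸ x) (m≤n⇒m⊓n≡m yk≤m) ⟩
  y * k ∸ x                                                           ∎
  where
  open ≡-Reasoning
  yk≤m : y * k ≤ k * n + 1
  yk≤m = ≤-trans (*-monoˡ-≤ k (<⇒≤ y<n)) (≤-trans (≤-reflexive (*-comm n k)) (m≤m+n (k * n) 1))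

staircase : ℕ → ℕ → ℕ
staircase k zero    = 0
staircase k (suc y) = staircase k y + suc (y * k + y)

areaFrom+sPositions : ∀ k n {x y p} → StaysAbove (k * n + 1) n x y p → x * n ≤ y * (k * n + 1) → y + countN p ≡ n →
  areaFrom (k * n + 1) n x y p + sum (sPositions (suc (x + y)) (SW p)) + staircase k y ≡ staircase k n
areaFrom+sPositions k n {y = y} done _ y+0≡n = cong (staircase k) (trans (sym (+-identityʳ y)) y+0≡n)
areaFrom+sPositions k n {x} {y} {E ∷ p} (stepE above rest) _ ≡n = areaFrom+sPositions k n rest above ≡n
areaFrom+sPositions k n {x} {y} {N ∷ p} (stepN above rest) at ≡n = begin
  rowCells m n x y + A + (suc (x + y) + B) + staircase k y
    ≡⟨ cong (λ z → z + A + (suc (x + y) + B) + staircase k y) row ⟩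
  y * k ∸ x + A + (suc (x + y) + B) + staircase k y
    ≡⟨ regroup (y * k ∸ x) x y A B (staircase k y) ⟩
  A + B + (staircase k y + suc (y * k ∸ x + x + y))
    ≡⟨ cong (λ z → A + B + (staircase k y + suc (z + y))) (m∸n+n≡m x≤yk) ⟩
  A + B + staircase k (suc y)
    ≡⟨ cong (λ z → A + sum (sPositions (suc z) (SW p)) + staircase k (suc y)) (+-suc x y) ⟨
  areaFrom m n x (suc y) p + sum (sPositions (suc (x + suc y)) (SW p)) + staircase k (suc y)
    ≡⟨ areaFrom+sPositions k n rest above (trans (sym (+-suc y (countN p))) ≡n) ⟩
  staircase k n ∎
  where
  open ≡-Reasoning
  m A B : ℕ
  m = k * n + 1
  A = areaFrom m n x (suc y) p
  B = sum (sPositions (suc (suc (x + y))) (SW p))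
  y<n : y < n
  y<n = ≤-trans (s≤s (m≤m+n y (countN p))) (≤-reflexive (trans (sym (+-suc y (countN p))) ≡n))
  x≤yk : x ≤ y * k
  x≤yk = above-diagonal⇒≤ k n x y y<n at
  row : rowCells m n x y ≡ y * k ∸ x
  row = rowCells-below k n x y y<n x≤yk
  regroup : ∀ r x y a b s → r + a + (suc (x + y) + b) + s ≡ a + b + (s + suc (r + x + y))
  regroup = solve-∀

countE-++ : ∀ (p q : Path) → countE (p ++ q) ≡ countE p + countE q
countE-++ []      q = refl
countE-++ (N ∷ p) q = countE-++ p q
countE-++ (E ∷ p) q = cong suc (countE-++ p q)

countN-++ : ∀ (p q : Path) → countN (p ++ q) ≡ countN p + countN q
countN-++ []      q = refl
countN-++ (N ∷ p) q = cong suc (countN-++ p q)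
countN-++ (E ∷ p) q = countN-++ p q

length≡countE+countN : ∀ (p : Path) → length p ≡ countE p + countN p
length≡countE+countN []      = refl
length≡countE+countN (N ∷ p) = trans (cong suc (length≡countE+countN p)) (sym (+-suc (countE p) (countN p)))
length≡countE+countN (E ∷ p) = cong suc (length≡countE+countN p)

-- The point (m, n - 1) before a final North step would lie strictly below the diagonal.
¬StaysAbove-∷ʳN : ∀ m n (q : Path) x y → 1 ≤ m → x * n ≤ y * m → StaysAbove m n x y (q ∷ʳ N) →
  x + countE q ≡ m → suc (y + countN q) ≡ n → ⊥
¬StaysAbove-∷ʳN m n [] x y 1≤m at _ x≡m y≡n = <-irrefl refl (≤-trans (+-monoˡ-≤ (y * m) 1≤m) (begin
  m + y * m     ≡⟨ cong (m +_) (*-comm y m) ⟩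
  m + m * y     ≡⟨ sym (*-suc m y) ⟩
  m * suc y     ≡⟨ cong₂ _*_ (sym (trans (sym (+-identityʳ x)) x≡m)) (trans (cong suc (sym (+-identityʳ y))) y≡n) ⟩
  x * n         ≤⟨ at ⟩
  y * m         ∎))
  where open ≤-Reasoning
¬StaysAbove-∷ʳN m n (N ∷ q) x y 1≤m _ (stepN at rest) x≡m y≡n =
  ¬StaysAbove-∷ʳN m n q x (suc y) 1≤m at rest x≡m (trans (cong suc (sym (+-suc y (countN q)))) y≡n)
¬StaysAbove-∷ʳN m n (E ∷ q) x y 1≤m _ (stepE at rest) x≡m y≡n =
  ¬StaysAbove-∷ʳN m n q (suc x) y 1≤m at rest (trans (sym (+-suc x (countE q))) x≡m) y≡n

InD-shape : ∀ k n D → 1 ≤ n → InD (k * n + 1) n D → ∃ λ q → D ≡ N ∷ (q ∷ʳ E)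
InD-shape k n []      1≤n d = ⊥-elim (<-irrefl refl (subst (1 ≤_) (sym (InD.numN d)) 1≤n))
InD-shape k n (E ∷ p) 1≤n d with InD.above d
... | stepE at _ = ⊥-elim (<-irrefl refl (≤-trans 1≤n (≤-trans (≤-reflexive (sym (+-identityʳ n))) at)))
InD-shape k n (N ∷ p) 1≤n d with reverseView p
... | [] = ⊥-elim (0≢1+n (trans (InD.numE d) (+-comm (k * n) 1)))
... | q ∶ _ ∶ʳ E = q , refl
... | q ∶ _ ∶ʳ N = ⊥-elim (¬StaysAbove-∷ʳN (k * n + 1) n (N ∷ q) 0 0 (≤-trans (s≤s z≤n) (≤-reflexive (+-comm 1 (k * n))))
                      z≤n (InD.above d) endE endN)
  where
  endE : countE q ≡ k * n + 1
  endE = trans (sym (trans (countE-++ q (N ∷ [])) (+-identityʳ _))) (InD.numE d)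
  endN : suc (suc (countN q)) ≡ n
  endN = trans (cong suc (sym (trans (countN-++ q (N ∷ [])) (+-comm _ 1)))) (InD.numN d)

take-length-++ : ∀ {A : Set} (xs ys : List A) → take (length xs) (xs ++ ys) ≡ xs
take-length-++ []       ys = refl
take-length-++ (x ∷ xs) ys = cong (x ∷_) (take-length-++ xs ys)

sPositions-∷ʳW : ∀ i w → sPositions i (w ∷ʳ W) ≡ sPositions i w
sPositions-∷ʳW i []      = refl
sPositions-∷ʳW i (S ∷ w) = cong (i ∷_) (sPositions-∷ʳW (suc i) w)
sPositions-∷ʳW i (W ∷ w) = sPositions-∷ʳW (suc i) w

sum-map-1-sPositions : ∀ i (q : Path) → sum (map (λ _ → 1) (sPositions i (SW q))) ≡ countN q
sum-map-1-sPositions i []      = refl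
sum-map-1-sPositions i (N ∷ q) = cong suc (sum-map-1-sPositions (suc i) q)
sum-map-1-sPositions i (E ∷ q) = sum-map-1-sPositions (suc i) q

sumBy-onHead-emptyCols : ∀ f n → sumBy (onHead f) (emptyCols n) ≡ 0
sumBy-onHead-emptyCols f zero    = refl
sumBy-onHead-emptyCols f (suc n) = sumBy-onHead-emptyCols f n

fill-word : ∀ k n q → InD (k * n + 1) n (N ∷ (q ∷ʳ E)) →
  take (k * n + 1 + n ∸ 2) (drop 1 (SW (N ∷ (q ∷ʳ E)))) ≡ SW q
fill-word k n q d = begin
  take (k * n + 1 + n ∸ 2) (drop 1 (SW D))  ≡⟨ cong₂ take letters (map-++ _ q (E ∷ [])) ⟩
  take (length (SW q)) (SW q ∷ʳ W)          ≡⟨ take-length-++ (SW q) (W ∷ []) ⟩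
  SW q                                      ∎
  where
  open ≡-Reasoning
  D : Path
  D = N ∷ (q ∷ʳ E)
  steps : suc (length q + 1) ≡ k * n + 1 + n
  steps = trans (cong suc (sym (length-++ q))) (trans (length≡countE+countN D) (cong₂ _+_ (InD.numE d) (InD.numN d)))
  letters : k * n + 1 + n ∸ 2 ≡ length (SW q)
  letters = trans (cong (_∸ 2) (sym steps)) (trans (m+n∸n≡m (length q) 1) (sym (length-map _ q)))

area+headSum : ∀ k n D T → InD (k * suc n + 1) (suc n) D → fill k (suc n) D ≡ just T →
  area (k * suc n + 1) (suc n) D + headSum T ≡ staircase k (suc n) × nonEmptyCount T ≡ suc n
area+headSum k n D T d filled with InD-shape k (suc n) D (s≤s z≤n) d
... | q , refl = areaSum , columns
  where
  run-q : run k 2 (SW q) (initArray (suc n)) ≡ just T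
  run-q = subst (λ w → run k 2 w (initArray (suc n)) ≡ just T) (fill-word k (suc n) q d) filled
  positions : sPositions 1 (SW (N ∷ (q ∷ʳ E))) ≡ 1 ∷ sPositions 2 (SW q)
  positions = cong (1 ∷_) (trans (cong (sPositions 2) (map-++ _ q (E ∷ []))) (sPositions-∷ʳW 2 (SW q)))
  heads : headSum T ≡ sum (sPositions 1 (SW (N ∷ (q ∷ʳ E))))
  heads = begin
    headSum T                                                   ≡⟨ run-heads (λ h → h) k (SW q) 2 (initArray (suc n)) run-q ⟩
    1 + sumBy (onHead λ h → h) (emptyCols n) + sum (map (λ h → h) (sPositions 2 (SW q)))
      ≡⟨ cong₂ (λ a b → 1 + a + sum b) (sumBy-onHead-emptyCols (λ h → h) n) (map-id (sPositions 2 (SW q))) ⟩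
    sum (1 ∷ sPositions 2 (SW q))                               ≡⟨ cong sum (sym positions) ⟩
    sum (sPositions 1 (SW (N ∷ (q ∷ʳ E))))                      ∎
    where open ≡-Reasoning
  areaSum : area (k * suc n + 1) (suc n) (N ∷ (q ∷ʳ E)) + headSum T ≡ staircase k (suc n)
  areaSum = trans (cong (area (k * suc n + 1) (suc n) (N ∷ (q ∷ʳ E)) +_) heads)
                  (trans (sym (+-identityʳ _)) (areaFrom+sPositions k (suc n) (InD.above d) z≤n (InD.numN d)))
  columns : nonEmptyCount T ≡ suc n
  columns = begin
    nonEmptyCount T                                             ≡⟨ run-heads (λ _ → 1) k (SW q) 2 (initArray (suc n)) run-q ⟩
    1 + sumBy (onHead λ _ → 1) (emptyCols n) + sum (map (λ _ → 1) (sPositions 2 (SW q)))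
      ≡⟨ cong₂ (λ a b → 1 + a + b) (sumBy-onHead-emptyCols (λ _ → 1) n) (sum-map-1-sPositions 2 q) ⟩
    suc (countN q)                                              ≡⟨ cong suc (sym (trans (countN-++ q (E ∷ [])) (+-identityʳ _))) ⟩
    countN (N ∷ (q ∷ʳ E))                                       ≡⟨ InD.numN d ⟩
    suc n                                                       ∎
    where open ≡-Reasoning

fill-invariant : ∀ k n D {T} → 1 ≤ k → fill k (suc n) D ≡ just T → ∃ λ t → FillInvariant k t T
fill-invariant k n D 1≤k = run-invariant k (take (k * suc n + 1 + suc n ∸ 2) (drop 1 (SW D))) 1 (initArray (suc n))
                                         (initArray-invariant k n 1≤k)

area-difference : ∀ {a a′ H G} k P j → a + (1 + H) ≡ staircase k (suc P) → a′ + G ≡ staircase k P →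
  G + suc k * P + 1 ≡ H + j → a + 1 ≡ a′ + j
area-difference {a} {a′} {H} {G} k P j big small heads = +-cancelʳ-≡ H (a + 1) (a′ + j) (begin
  a + 1 + H                       ≡⟨ +-assoc a 1 H ⟩
  a + (1 + H)                     ≡⟨ big ⟩
  staircase k P + suc (P * k + P) ≡⟨ cong (_+ suc (P * k + P)) (sym small) ⟩
  a′ + G + suc (P * k + P)        ≡⟨ regroup a′ G P k ⟩
  a′ + (G + suc k * P + 1)        ≡⟨ cong (a′ +_) heads ⟩
  a′ + (H + j)                    ≡⟨ x∙yz≈xz∙y a′ H j ⟩
  a′ + j + H                      ∎)
  where
  open ≡-Reasoning
  regroup : ∀ a g p k → a + g + suc (p * k + p) ≡ a + (g + suc k * p + 1)
  regroup = solve-∀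

corollary4p7 : (k n : ℕ) → 1 ≤ k → 2 ≤ n →
    (D D' : Path) →
    InD (k * n + 1) n D →
    InD (k * (n ∸ 1) + 1) (n ∸ 1) D' →
    (T T' : Array) →
    fill k n D ≡ just T →
    fill k (n ∸ 1) D' ≡ just T' →
    red T ≡ T' →
    (j : ℕ) →
    entry T 0 k ≡ just (k + j) →
    area (k * n + 1) n D + 1 ≡ area (k * (n ∸ 1) + 1) (n ∸ 1) D' + j
corollary4p7 k (suc zero) _ (s≤s ())
corollary4p7 k (suc (suc p)) 1≤k _ D D′ dD dD′ T T′ fT fT′ refl j bottom
  with fill-invariant k (suc p) D 1≤k fT
... | t , inv with filled-rank-heads k t T j 1≤k inv bottom
... | r , cs , refl , heads with area+headSum k (suc p) D _ dD fT
... | areaD , columns = area-difference k (suc p) j areaD areaD′ heads′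
  where
  G : ℕ
  G = sumBy (onHead (rank (concat cs))) cs
  areaD′ : area (k * suc p + 1) (suc p) D′ + G ≡ staircase k (suc p)
  areaD′ = trans (cong (_ +_) (sym (headSum-map (rank (concat cs)) cs))) (proj₁ (area+headSum k p D′ _ dD′ fT′))
  heads′ : G + suc k * suc p + 1 ≡ headSum cs + j
  heads′ = subst (λ c → G + suc k * c + 1 ≡ headSum cs + j) (suc-injective columns) heads
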